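{- Let $g=(g(1),g(2),\dots)$ be a sequence of nonzero integers, and let $f$ be the sequence defined by $f(n)=\prod_{d\mid n} g(d)$ (product over the positive divisors $d$ of $n$). Then $f$ is binomid at every level: for every integer $c\ge 0$, the column sequence $C_c=(C_c(N))_{N\ge1}$ defined by $C_c(N)=\left[{N+c-1 \atop c}\right]_f$ is binomid.
   Context: For a sequence $h=(h_1,h_2,\dots)$ of nonzero rational numbers and integers $0\le k\le n$, the $h$-binomial coefficient is $\left[{n\atop k}\right]_h=\dfrac{h_nh_{n-1}\cdots h_{n-k+1}}{h_kh_{k-1}\cdots h_1}$ (equal to $1$ when $k=0$). The sequence $h$ is called binomid if every $\left[{n\atop k}\right]_h$ with $0\le k\le n$ is an integer. A sequence of the form $f(n)=\prod_{d\mid n}g(d)$ with $g$ an integer sequence is called a divisor-product. -}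

module Defs where

open import Data.Nat as ℕ using (ℕ; zero; suc; _∸_; _≤_)
open import Data.Nat.Divisibility using (_∣_; _∣?_)
open import Data.Integer as ℤ using (ℤ)
open import Data.Rational as ℚ using (ℚ; 0ℚ; 1ℚ; _/_; _÷_; ≢-nonZero)
open import Data.Rational.Properties using (_≟_)
open import Data.List using (List; map; foldr; filter; upTo)
open import Data.Product using (∃; _×_)
open import Relation.Binary.PropositionalEquality using (_≡_; _≢_)
open import Relation.Nullary using (yes; no)

-- Sequences h = (h 1, h 2, ...) are functions ℕ → ℚ; the value at 0 is ignored.

prodℚ : List ℚ → ℚ
prodℚ = foldr ℚ._*_ 1ℚ

-- division, total: the zero-denominator branch is never used for nonzero sequences
divℚ : ℚ → ℚ → ℚ
divℚ p q with q ≟ 0ℚ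
... | yes _   = 0ℚ
... | no q≢0 = _÷_ p q {{≢-nonZero q≢0}}

hbinom : (ℕ → ℚ) → ℕ → ℕ → ℚ
hbinom h n k = divℚ (prodℚ (map (λ i → h (n ∸ i)) (upTo k)))
                    (prodℚ (map (λ i → h (suc i)) (upTo k)))

IsInteger : ℚ → Set
IsInteger q = ∃ λ (z : ℤ) → q ≡ z / 1

Binomid : (ℕ → ℚ) → Set
Binomid h = (∀ n → 1 ≤ n → h n ≢ 0ℚ)
          × (∀ n k → k ≤ n → IsInteger (hbinom h n k))

divisors : ℕ → List ℕ
divisors n = filter (_∣? n) (map suc (upTo n))

divProd : (ℕ → ℤ) → ℕ → ℚ
divProd g n = prodℚ (map (λ d → g d / 1) (divisors n))

column : (ℕ → ℚ) → ℕ → ℕ → ℚ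
column f c N = hbinom f (N ℕ.+ c ∸ 1) c

-- Fix M and regard integers of the form ∏_{d ≤ M} g(d)^{e(d)} as exponent vectors e. The value
-- f(m) has exponent [d ∣ m] at g(d), so C_c(x + 1) has exponent
--   E_d(x) = #{multiples of d among x + 1, …, x + c} − ⌊c/d⌋,
-- nonnegative because m ↦ ⌊m/d⌋ is superadditive. An h-binomial coefficient of C_c is then a
-- quotient of two such products with exponent ∑_{i<k} E_d(n − 1 − i) − ∑_{i<k} E_d(i) at g(d).
-- This is nonnegative because the partial sums T(m) = ∑_{x<m} E_d(x) are superadditive:
-- T(d + m) = (c mod d) + T(m), and within one period T(a) = a ∸ (d − c mod d).
module Submission where

open import Defs
open import Data.Nat using (ℕ; _≤_)
open import Data.Integer using (ℤ; 0ℤ)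
open import Data.Integer using (_^_)
open import Relation.Binary.PropositionalEquality using (_≢_)

open import Algebra.Bundles using (CommutativeMonoid)
open import Data.Bool using (if_then_else_)
open import Data.Empty using (⊥-elim)
open import Data.List using (map; filter; upTo; applyUpTo)
open import Data.List.Properties using (map-upTo)
open import Data.Nat as ℕ using (zero; suc; _+_; _∸_; _<_; _%_; _/_; s≤s; z≤n)
open import Data.Nat.DivMod using (m≡m%n+[m/n]*n; m%n<n)
open import Data.Nat.Coprimality as Coprime using (1-coprimeTo)
open import Data.Nat.Divisibility
  using (_∣_; _∣?_; _∤_; >⇒∤; ∣-refl; ∣m∣n⇒∣m+n; ∣m+n∣m⇒∣n)
open import Data.Nat.Properties as ℕP using ()
open import Data.Nat.Induction using (<-rec)
import Data.Integer as ℤ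
open import Data.Integer.Properties as ℤP using ()
open import Data.Rational as ℚ using (ℚ; mkℚ; 0ℚ; 1ℚ; ↥_)
open import Data.Rational.Properties as ℚP using (↥p/↧p≡p)
open import Data.Product using (_×_; _,_)
open import Data.Sum using (inj₁; inj₂)
open import Function using (_∘_)
open import Relation.Binary.PropositionalEquality
  using (_≡_; refl; sym; cong; cong₂; trans; subst; module ≡-Reasoning)
open import Relation.Nullary using (yes; no; does)
open import Relation.Nullary.Decidable using (dec-true; dec-false)

module FiniteSum {a ℓ} (M : CommutativeMonoid a ℓ) where

  open CommutativeMonoid M renaming (refl to ≈-refl; trans to ≈-trans; sym to ≈-sym)
  open import Relation.Binary.Reasoning.Setoid setoid

  ∑ : ℕ → (ℕ → Carrier) → Carrier
  ∑ zero    f = ε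
  ∑ (suc n) f = f 0 ∙ ∑ n (f ∘ suc)

  ∑-cong : ∀ n {f h} → (∀ i → i < n → f i ≈ h i) → ∑ n f ≈ ∑ n h
  ∑-cong zero    f≈h = ≈-refl
  ∑-cong (suc n) f≈h =
    ∙-cong (f≈h 0 (s≤s z≤n)) (∑-cong n (λ i i<n → f≈h (suc i) (s≤s i<n)))

  ∑-ε : ∀ n {f} → (∀ i → i < n → f i ≈ ε) → ∑ n f ≈ ε
  ∑-ε zero    f≈ε = ≈-refl
  ∑-ε (suc n) f≈ε =
    ≈-trans (∙-cong (f≈ε 0 (s≤s z≤n)) (∑-ε n (λ i i<n → f≈ε (suc i) (s≤s i<n)))) (identityˡ ε)

  ∑-+ : ∀ m n f → ∑ (m + n) f ≈ ∑ m f ∙ ∑ n (λ i → f (m + i))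
  ∑-+ zero    n f = ≈-sym (identityˡ _)
  ∑-+ (suc m) n f = ≈-trans (∙-congˡ (∑-+ m n (f ∘ suc))) (≈-sym (assoc (f 0) _ _))

  ∑-last : ∀ n f → ∑ (suc n) f ≈ ∑ n f ∙ f n
  ∑-last zero    f = comm (f 0) ε
  ∑-last (suc n) f = ≈-trans (∙-congˡ (∑-last n (f ∘ suc))) (≈-sym (assoc (f 0) _ _))

  ∑-reverse : ∀ n f → ∑ n (λ i → f (n ∸ suc i)) ≈ ∑ n f
  ∑-reverse zero    f = ≈-refl
  ∑-reverse (suc n) f = begin
    f n ∙ ∑ n (λ i → f (n ∸ suc i)) ≈⟨ ∙-congˡ (∑-reverse n f) ⟩
    f n ∙ ∑ n f                     ≈⟨ comm (f n) _ ⟩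
    ∑ n f ∙ f n                     ≈⟨ ≈-sym (∑-last n f) ⟩
    ∑ (suc n) f                     ∎

  ∑-distrib : ∀ n f h → ∑ n (λ i → f i ∙ h i) ≈ ∑ n f ∙ ∑ n h
  ∑-distrib zero    f h = ≈-sym (identityˡ ε)
  ∑-distrib (suc n) f h = begin
    (f 0 ∙ h 0) ∙ ∑ n (λ i → f (suc i) ∙ h (suc i))  ≈⟨ ∙-congˡ (∑-distrib n (f ∘ suc) (h ∘ suc)) ⟩
    (f 0 ∙ h 0) ∙ (∑ n (f ∘ suc) ∙ ∑ n (h ∘ suc))    ≈⟨ interchange (f 0) (h 0) _ _ ⟩
    (f 0 ∙ ∑ n (f ∘ suc)) ∙ (h 0 ∙ ∑ n (h ∘ suc))    ∎
    where
    open import Algebra.Properties.CommutativeSemigroup commutativeSemigroup using (interchange)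

open FiniteSum ℕP.+-0-commutativeMonoid using (∑; ∑-cong; ∑-ε; ∑-+; ∑-last; ∑-reverse)
open FiniteSum ℤP.*-1-commutativeMonoid using ()
  renaming (∑ to ∏; ∑-cong to ∏-cong; ∑-ε to ∏-ε; ∑-+ to ∏-+; ∑-distrib to ∏-distrib)

∏-≢0 : ∀ n {f} → (∀ i → i < n → f i ≢ 0ℤ) → ∏ n f ≢ 0ℤ
∏-≢0 zero    f≢0 ()
∏-≢0 (suc n) {f} f≢0 eq with ℤP.i*j≡0⇒i≡0∨j≡0 (f 0) eq
... | inj₁ f₀≡0 = f≢0 0 (s≤s z≤n) f₀≡0
... | inj₂ rest≡0 = ∏-≢0 n (λ i i<n → f≢0 (suc i) (s≤s i<n)) rest≡0

toℚ : ℤ → ℚ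
toℚ z = z ℚ./ 1

toℚ≡mkℚ : ∀ z → toℚ z ≡ mkℚ z 0 (Coprime.sym (1-coprimeTo ℤ.∣ z ∣))
toℚ≡mkℚ z = ↥p/↧p≡p (mkℚ z 0 _)

toℚ-* : ∀ a b → toℚ (a ℤ.* b) ≡ toℚ a ℚ.* toℚ b
toℚ-* a b = sym (cong₂ ℚ._*_ (toℚ≡mkℚ a) (toℚ≡mkℚ b))

toℚ-injective : ∀ {a b} → toℚ a ≡ toℚ b → a ≡ b
toℚ-injective {a} {b} eq = cong ↥_ (trans (sym (toℚ≡mkℚ a)) (trans eq (toℚ≡mkℚ b)))

divℚ-toℚ-*-cancelʳ : ∀ x {y} → y ≢ 0ℤ → divℚ (toℚ (x ℤ.* y)) (toℚ y) ≡ toℚ x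
divℚ-toℚ-*-cancelʳ x {y} y≢0 with toℚ y ℚP.≟ 0ℚ
... | yes y≡0  = ⊥-elim (y≢0 (toℚ-injective y≡0))
... | no  y≢0′ = begin
  toℚ (x ℤ.* y) ℚ.* ℚ.1/ toℚ y        ≡⟨ cong (ℚ._* _) (toℚ-* x y) ⟩
  (toℚ x ℚ.* toℚ y) ℚ.* ℚ.1/ toℚ y    ≡⟨ ℚP.*-assoc (toℚ x) (toℚ y) _ ⟩
  toℚ x ℚ.* (toℚ y ℚ.* ℚ.1/ toℚ y)    ≡⟨ cong (toℚ x ℚ.*_) (ℚP.*-inverseʳ (toℚ y)) ⟩
  toℚ x ℚ.* 1ℚ                        ≡⟨ ℚP.*-identityʳ (toℚ x) ⟩
  toℚ x                               ∎
  where
  open ≡-Reasoning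
  instance _ = ℚ.≢-nonZero y≢0′

prodℚ-upTo-toℚ : ∀ k {F : ℕ → ℚ} {H : ℕ → ℤ} →
                 (∀ i → i < k → F i ≡ toℚ (H i)) → prodℚ (map F (upTo k)) ≡ toℚ (∏ k H)
prodℚ-upTo-toℚ k {F} F≡H = trans (cong prodℚ (map-upTo F k)) (prodℚ-applyUpTo k F≡H)
  where
  prodℚ-applyUpTo : ∀ k {F H} → (∀ i → i < k → F i ≡ toℚ (H i)) →
                    prodℚ (applyUpTo F k) ≡ toℚ (∏ k H)
  prodℚ-applyUpTo zero    F≡H = refl
  prodℚ-applyUpTo (suc k) {H = H} F≡H =
    trans (cong₂ ℚ._*_ (F≡H 0 (s≤s z≤n)) (prodℚ-applyUpTo k (λ i i<k → F≡H (suc i) (s≤s i<k))))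
      (sym (toℚ-* (H 0) _))

[_∣_] : ℕ → ℕ → ℕ
[ d ∣ m ] = if does (d ∣? m) then 1 else 0

[∣]-yes : ∀ {d m} → d ∣ m → [ d ∣ m ] ≡ 1
[∣]-yes {d} {m} d∣m = cong (if_then 1 else 0) (dec-true (d ∣? m) d∣m)

[∣]-no : ∀ {d m} → d ∤ m → [ d ∣ m ] ≡ 0
[∣]-no {d} {m} d∤m = cong (if_then 1 else 0) (dec-false (d ∣? m) d∤m)

module Monomial (g : ℕ → ℤ) where

  -- ∏_{d = 1}^{M} g(d)^{e(d)}; the exponent e 0 is never used.
  monomial : ℕ → (ℕ → ℕ) → ℤ
  monomial M e = ∏ M (λ i → g (suc i) ^ e (suc i))

  monomial-cong : ∀ M {a b} → (∀ d → a (suc d) ≡ b (suc d)) → monomial M a ≡ monomial M b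
  monomial-cong M a≡b = ∏-cong M (λ i _ → cong (g (suc i) ^_) (a≡b i))

  monomial-+ : ∀ M a b → monomial M (λ d → a d + b d) ≡ monomial M a ℤ.* monomial M b
  monomial-+ M a b = trans (∏-cong M (λ i _ → ℤP.^-distribˡ-+-* (g (suc i)) (a (suc i)) (b (suc i))))
                            (∏-distrib M _ _)

  monomial-∸ : ∀ M a b → (∀ d → b (suc d) ≤ a (suc d)) →
               monomial M a ≡ monomial M (λ d → a d ∸ b d) ℤ.* monomial M b
  monomial-∸ M a b b≤a =
    trans (monomial-cong M {a} {λ d → a d ∸ b d + b d} (λ d → sym (ℕP.m∸n+n≡m (b≤a d))))
          (monomial-+ M (λ d → a d ∸ b d) b)

  ∏-monomial : ∀ M k (e : ℕ → ℕ → ℕ) →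
               ∏ k (λ i → monomial M (e i)) ≡ monomial M (λ d → ∑ k (λ i → e i d))
  ∏-monomial M zero    e = sym (∏-ε M (λ _ _ → refl))
  ∏-monomial M (suc k) e = trans (cong (monomial M (e 0) ℤ.*_) (∏-monomial M k (e ∘ suc)))
                                 (sym (monomial-+ M (e 0) (λ d → ∑ k (λ i → e (suc i) d))))

  monomial-restrict : ∀ {m M} e → m ≤ M → (∀ d → m < d → e d ≡ 0) → monomial M e ≡ monomial m e
  monomial-restrict {m} {M} e m≤M e≡0 = begin
    monomial M e
      ≡⟨ cong (λ n → monomial n e) (sym (ℕP.m+[n∸m]≡n m≤M)) ⟩
    monomial (m + (M ∸ m)) e
      ≡⟨ ∏-+ m (M ∸ m) _ ⟩
    monomial m e ℤ.* ∏ (M ∸ m) (λ i → g (suc (m + i)) ^ e (suc (m + i)))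
      ≡⟨ cong (monomial m e ℤ.*_) (∏-ε (M ∸ m) (λ i _ → cong (g (suc (m + i)) ^_) (beyond-m i))) ⟩
    monomial m e ℤ.* ℤ.1ℤ
      ≡⟨ ℤP.*-identityʳ _ ⟩
    monomial m e ∎
    where
    open ≡-Reasoning
    beyond-m : ∀ i → e (suc (m + i)) ≡ 0
    beyond-m i = e≡0 _ (s≤s (ℕP.m≤m+n m i))

  monomial-≢0 : (∀ d → 1 ≤ d → g d ≢ 0ℤ) → ∀ M e → monomial M e ≢ 0ℤ
  monomial-≢0 g≢0 M e = ∏-≢0 M (λ i _ gᵢ^e≡0 →
    g≢0 (suc i) (s≤s z≤n) (ℤP.i^n≡0⇒i≡0 (g (suc i)) (e (suc i)) gᵢ^e≡0))

  divProd-monomial : ∀ {m M} → 1 ≤ m → m ≤ M → divProd g m ≡ toℚ (monomial M [_∣ m ])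
  divProd-monomial {m} {M} 1≤m m≤M = begin
    divProd g m
      ≡⟨ cong (λ ds → prodℚ (map (toℚ ∘ g) (filter (_∣? m) ds))) (map-upTo suc m) ⟩
    prodℚ (map (toℚ ∘ g) (filter (_∣? m) (applyUpTo suc m)))
      ≡⟨ prodℚ-filter m suc ⟩
    toℚ (monomial m [_∣ m ])
      ≡⟨ cong toℚ (sym (monomial-restrict [_∣ m ] m≤M non-divisors)) ⟩
    toℚ (monomial M [_∣ m ]) ∎
    where
    open ≡-Reasoning
    non-divisors : ∀ d → m < d → [ d ∣ m ] ≡ 0
    non-divisors d m<d = [∣]-no (>⇒∤ {{ℕ.>-nonZero 1≤m}} m<d)
    factors : ℕ → (ℕ → ℕ) → ℤ
    factors n s = ∏ n (λ i → g (s i) ^ [ s i ∣ m ])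
    prodℚ-filter : ∀ n s →
                   prodℚ (map (toℚ ∘ g) (filter (_∣? m) (applyUpTo s n))) ≡ toℚ (factors n s)
    prodℚ-filter zero    s = refl
    prodℚ-filter (suc n) s with s 0 ∣? m
    ... | yes _ = trans (cong (toℚ (g (s 0)) ℚ.*_) (prodℚ-filter n (s ∘ suc)))
                        (sym (trans (cong (λ x → toℚ (x ℤ.* rest)) (ℤP.*-identityʳ (g (s 0))))
                                    (toℚ-* (g (s 0)) rest)))
      where rest = factors n (s ∘ suc)
    ... | no  _ = trans (prodℚ-filter n (s ∘ suc)) (cong toℚ (sym (ℤP.*-identityˡ (factors n (s ∘ suc)))))

  hbinom-monomial :
    (∀ d → 1 ≤ d → g d ≢ 0ℤ) → (h : ℕ → ℚ) (M : ℕ) {n k : ℕ} (e : ℕ → ℕ → ℕ) → k ≤ n →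
    (∀ N → 1 ≤ N → N ≤ n → h N ≡ toℚ (monomial M (e N))) →
    (∀ d → ∑ k (λ i → e (suc i) (suc d)) ≤ ∑ k (λ i → e (n ∸ i) (suc d))) →
    hbinom h n k ≡ toℚ (monomial M (λ d → ∑ k (λ i → e (n ∸ i) d) ∸ ∑ k (λ i → e (suc i) d)))
  hbinom-monomial g≢0 h M {n} {k} e k≤n h≡ den≤num = begin
    hbinom h n k
      ≡⟨ cong₂ divℚ (prodℚ-monomial (n ∸_) (λ i i<k → ℕP.m<n⇒0<n∸m (i<n i<k) , ℕP.m∸n≤m n i))
                    (prodℚ-monomial suc (λ i i<k → s≤s z≤n , i<n i<k)) ⟩
    divℚ (toℚ (monomial M num)) (toℚ (monomial M den))
      ≡⟨ cong (λ x → divℚ (toℚ x) (toℚ (monomial M den))) (monomial-∸ M num den den≤num) ⟩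
    divℚ (toℚ (monomial M (λ d → num d ∸ den d) ℤ.* monomial M den)) (toℚ (monomial M den))
      ≡⟨ divℚ-toℚ-*-cancelʳ (monomial M (λ d → num d ∸ den d)) (monomial-≢0 g≢0 M den) ⟩
    toℚ (monomial M (λ d → num d ∸ den d)) ∎
    where
    open ≡-Reasoning
    num den : ℕ → ℕ
    num d = ∑ k (λ i → e (n ∸ i) d)
    den d = ∑ k (λ i → e (suc i) d)
    i<n : ∀ {i} → i < k → i < n
    i<n i<k = ℕP.<-≤-trans i<k k≤n
    prodℚ-monomial : ∀ (s : ℕ → ℕ) → (∀ i → i < k → 1 ≤ s i × s i ≤ n) →
                     prodℚ (map (h ∘ s) (upTo k)) ≡ toℚ (monomial M (λ d → ∑ k (λ i → e (s i) d)))
    prodℚ-monomial s s-in-range =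
      trans (prodℚ-upTo-toℚ k (λ i i<k → let 1≤sᵢ , sᵢ≤n = s-in-range i i<k in h≡ (s i) 1≤sᵢ sᵢ≤n))
            (cong toℚ (∏-monomial M k (e ∘ s)))

Superadditive : (ℕ → ℕ) → Set
Superadditive T = ∀ a b → T a + T b ≤ T (a + b)

∑-≤-+ : ∀ m n f → ∑ m f ≤ ∑ (m + n) f
∑-≤-+ m n f = subst (∑ m f ≤_) (sym (∑-+ m n f)) (ℕP.m≤m+n _ _)

periodic-induction : ∀ d .{{_ : ℕ.NonZero d}} (P : ℕ → Set) →
                     (∀ x → x < d → P x) → (∀ x → P x → P (d + x)) → ∀ x → P x
periodic-induction d P base step = <-rec P induct
  where
  induct : ∀ x → (∀ {y} → y < x → P y) → P x
  induct x rec with x ℕ.<? d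
  ... | yes x<d = base x x<d
  ... | no  x≮d = subst P (ℕP.m+[n∸m]≡n d≤x) (step (x ∸ d) (rec x∸d<x))
    where
    d≤x = ℕP.≮⇒≥ x≮d
    x∸d<x = ℕP.∸-monoʳ-< (ℕ.>-nonZero⁻¹ d) d≤x

superadditive-periodic : ∀ d .{{_ : ℕ.NonZero d}} r {T : ℕ → ℕ} → (∀ m → T (d + m) ≡ r + T m) →
                         (∀ a b → a < d → b < d → T a + T b ≤ T (a + b)) → Superadditive T
superadditive-periodic d r {T} T-d+ base =
  periodic-induction d (λ a → ∀ b → T a + T b ≤ T (a + b))
    (λ a a<d → periodic-induction d (λ b → T a + T b ≤ T (a + b))
                 (λ b b<d → base a b a<d b<d) (step-b a))
    step-a
  where
  open ℕP.≤-Reasoning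
  open import Algebra.Properties.CommutativeSemigroup ℕP.+-commutativeSemigroup using (x∙yz≈y∙xz)
  step-b : ∀ a b → T a + T b ≤ T (a + b) → T a + T (d + b) ≤ T (a + (d + b))
  step-b a b ih = begin
    T a + T (d + b)      ≡⟨ cong (T a +_) (T-d+ b) ⟩
    T a + (r + T b)      ≡⟨ x∙yz≈y∙xz (T a) r (T b) ⟩
    r + (T a + T b)      ≤⟨ ℕP.+-monoʳ-≤ r ih ⟩
    r + T (a + b)        ≡⟨ sym (T-d+ (a + b)) ⟩
    T (d + (a + b))      ≡⟨ cong T (x∙yz≈y∙xz d a b) ⟩
    T (a + (d + b))      ∎
  step-a : ∀ a → (∀ b → T a + T b ≤ T (a + b)) → ∀ b → T (d + a) + T b ≤ T ((d + a) + b)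
  step-a a ih b = begin
    T (d + a) + T b      ≡⟨ cong (_+ T b) (T-d+ a) ⟩
    (r + T a) + T b      ≡⟨ ℕP.+-assoc r (T a) (T b) ⟩
    r + (T a + T b)      ≤⟨ ℕP.+-monoʳ-≤ r (ih b) ⟩
    r + T (a + b)        ≡⟨ sym (T-d+ (a + b)) ⟩
    T (d + (a + b))      ≡⟨ cong T (sym (ℕP.+-assoc d a b)) ⟩
    T ((d + a) + b)      ∎

∑-split-reversed : ∀ f {n k} → k ≤ n → ∑ n f ≡ ∑ (n ∸ k) f + ∑ k (λ i → f (n ∸ suc i))
∑-split-reversed f {n} {k} k≤n = begin
  ∑ n f                                    ≡⟨ cong (λ n → ∑ n f) (sym (ℕP.m∸n+n≡m k≤n)) ⟩
  ∑ (m + k) f                              ≡⟨ ∑-+ m k f ⟩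
  ∑ m f + ∑ k (λ i → f (m + i))            ≡⟨ cong (∑ m f +_) (sym (∑-reverse k (λ i → f (m + i)))) ⟩
  ∑ m f + ∑ k (λ i → f (m + (k ∸ suc i)))  ≡⟨ cong (∑ m f +_) (∑-cong k (λ i i<k → cong f (tail-index i<k))) ⟩
  ∑ m f + ∑ k (λ i → f (n ∸ suc i))        ∎
  where
  open ≡-Reasoning
  m = n ∸ k
  tail-index : ∀ {i} → i < k → m + (k ∸ suc i) ≡ n ∸ suc i
  tail-index {i} i<k = trans (sym (ℕP.+-∸-assoc m i<k)) (cong (_∸ suc i) (ℕP.m∸n+n≡m k≤n))

superadditive-∑⇒initial≤final : ∀ E {n k} → Superadditive (λ m → ∑ m E) → k ≤ n →
                                 ∑ k E ≤ ∑ k (λ i → E (n ∸ suc i))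
superadditive-∑⇒initial≤final E {n} {k} superadd k≤n =
  ℕP.+-cancelˡ-≤ (∑ (n ∸ k) E) _ _ (subst (∑ (n ∸ k) E + ∑ k E ≤_) split (superadd (n ∸ k) k))
  where
  split : ∑ ((n ∸ k) + k) E ≡ ∑ (n ∸ k) E + ∑ k (λ i → E (n ∸ suc i))
  split = trans (cong (λ n → ∑ n E) (ℕP.m∸n+n≡m k≤n)) (∑-split-reversed E k≤n)

module Multiples (d-1 c : ℕ) where

  d : ℕ
  d = suc d-1

  open ℕP.≤-Reasoning
  open import Algebra.Properties.CommutativeSemigroup ℕP.+-commutativeSemigroup
    using (x∙yz≈y∙xz; interchange)

  [∣]-d+ : ∀ m → [ d ∣ d + m ] ≡ [ d ∣ m ]
  [∣]-d+ m with d ∣? m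
  ... | yes d∣m = trans ([∣]-yes {d} (∣m∣n⇒∣m+n ∣-refl d∣m)) (sym ([∣]-yes {d} d∣m))
  ... | no  d∤m = trans ([∣]-no {d} (d∤m ∘ (λ d∣d+m → ∣m+n∣m⇒∣n d∣d+m ∣-refl))) (sym ([∣]-no {d} d∤m))

  multiples : ℕ → ℕ
  multiples m = ∑ m (λ i → [ d ∣ suc i ])

  multiples-< : ∀ {y} → y < d → multiples y ≡ 0
  multiples-< y<d = ∑-ε _ (λ i i<y → [∣]-no {d} (>⇒∤ (ℕP.≤-<-trans i<y y<d)))

  multiples-d+ : ∀ y → multiples (d + y) ≡ suc (multiples y)
  multiples-d+ y = begin-equality
    multiples (d + y)                               ≡⟨ ∑-+ d y (λ i → [ d ∣ suc i ]) ⟩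
    multiples d + ∑ y (λ i → [ d ∣ suc (d + i) ])   ≡⟨ cong₂ _+_ multiples-d (∑-cong y (λ i _ → shift i)) ⟩
    1 + multiples y                                 ∎
    where
    multiples-d : multiples d ≡ 1
    multiples-d = trans (∑-last d-1 (λ i → [ d ∣ suc i ]))
                        (cong₂ _+_ (multiples-< (ℕP.n<1+n d-1)) ([∣]-yes {d} ∣-refl))
    shift : ∀ i → [ d ∣ suc (d + i) ] ≡ [ d ∣ suc i ]
    shift i = trans (cong [ d ∣_] (sym (ℕP.+-suc d i))) ([∣]-d+ (suc i))

  multiples-+* : ∀ q y → multiples (y + q ℕ.* d) ≡ q + multiples y
  multiples-+* zero    y = cong multiples (ℕP.+-identityʳ y)
  multiples-+* (suc q) y = begin-equality
    multiples (y + (d + q ℕ.* d))   ≡⟨ cong multiples (x∙yz≈y∙xz y d (q ℕ.* d)) ⟩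
    multiples (d + (y + q ℕ.* d))   ≡⟨ multiples-d+ _ ⟩
    suc (multiples (y + q ℕ.* d))   ≡⟨ cong suc (multiples-+* q y) ⟩
    suc (q + multiples y)           ∎

  multiples-superadditive : Superadditive multiples
  multiples-superadditive = superadditive-periodic d 1 multiples-d+ below-d
    where
    below-d : ∀ a b → a < d → b < d → multiples a + multiples b ≤ multiples (a + b)
    below-d a b a<d _ = begin
      multiples a + multiples b   ≡⟨ cong (_+ multiples b) (multiples-< a<d) ⟩
      multiples b                 ≤⟨ ∑-≤-+ b a _ ⟩
      multiples (b + a)           ≡⟨ cong multiples (ℕP.+-comm b a) ⟩
      multiples (a + b)           ∎

  window : ℕ → ℕ
  window x = ∑ c (λ i → [ d ∣ x + c ∸ i ])

  window+multiples : ∀ x → window x + multiples x ≡ multiples (x + c)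
  window+multiples x = sym (begin-equality
    multiples (x + c)
      ≡⟨ ∑-split-reversed _ (ℕP.m≤n+m c x) ⟩
    multiples (x + c ∸ c) + ∑ c (λ i → [ d ∣ suc (x + c ∸ suc i) ])
      ≡⟨ cong₂ _+_ (cong multiples (ℕP.m+n∸n≡m x c)) (∑-cong c (λ i i<c → cong [ d ∣_] (suc-∸ i<c))) ⟩
    multiples x + window x
      ≡⟨ ℕP.+-comm (multiples x) (window x) ⟩
    window x + multiples x ∎)
    where
    suc-∸ : ∀ {i} → i < c → suc (x + c ∸ suc i) ≡ x + c ∸ i
    suc-∸ i<c = sym (ℕP.+-∸-assoc 1 (ℕP.≤-trans i<c (ℕP.m≤n+m c x)))

  multiples≤window : ∀ x → multiples c ≤ window x
  multiples≤window x = ℕP.+-cancelʳ-≤ (multiples x) _ _ (begin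
    multiples c + multiples x   ≡⟨ ℕP.+-comm (multiples c) (multiples x) ⟩
    multiples x + multiples c   ≤⟨ multiples-superadditive x c ⟩
    multiples (x + c)           ≡⟨ sym (window+multiples x) ⟩
    window x + multiples x      ∎)

  window-d+ : ∀ x → window (d + x) ≡ window x
  window-d+ x = ℕP.+-cancelʳ-≡ (multiples (d + x)) _ _ (begin-equality
    window (d + x) + multiples (d + x)   ≡⟨ window+multiples (d + x) ⟩
    multiples (d + x + c)                ≡⟨ cong multiples (ℕP.+-assoc d x c) ⟩
    multiples (d + (x + c))              ≡⟨ multiples-d+ (x + c) ⟩
    suc (multiples (x + c))              ≡⟨ cong suc (sym (window+multiples x)) ⟩
    suc (window x + multiples x)         ≡⟨ sym (ℕP.+-suc (window x) (multiples x)) ⟩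
    window x + suc (multiples x)         ≡⟨ cong (window x +_) (sym (multiples-d+ x)) ⟩
    window x + multiples (d + x)         ∎)

  -- the exponent of g d in C_c (x + 1)
  excess : ℕ → ℕ
  excess x = window x ∸ multiples c

  excessSum : ℕ → ℕ
  excessSum m = ∑ m excess

  r q t : ℕ
  r = c % d
  q = c / d
  t = d ∸ r

  r<d : r < d
  r<d = m%n<n c d

  t+r≡d : t + r ≡ d
  t+r≡d = ℕP.m∸n+n≡m (ℕP.<⇒≤ r<d)

  multiples-c : multiples c ≡ q
  multiples-c = begin-equality
    multiples c             ≡⟨ cong multiples (m≡m%n+[m/n]*n c d) ⟩
    multiples (r + q ℕ.* d) ≡⟨ multiples-+* q r ⟩
    q + multiples r         ≡⟨ cong (q +_) (multiples-< r<d) ⟩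
    q + 0                   ≡⟨ ℕP.+-identityʳ q ⟩
    q                       ∎

  excess-<d : ∀ {x} → x < d → excess x ≡ multiples (x + r)
  excess-<d {x} x<d = begin-equality
    window x ∸ multiples c        ≡⟨ cong₂ _∸_ window-x multiples-c ⟩
    (q + multiples (x + r)) ∸ q   ≡⟨ ℕP.m+n∸m≡n q _ ⟩
    multiples (x + r)             ∎
    where
    window-x : window x ≡ q + multiples (x + r)
    window-x = begin-equality
      window x                        ≡⟨ sym (ℕP.+-identityʳ _) ⟩
      window x + 0                    ≡⟨ cong (window x +_) (sym (multiples-< x<d)) ⟩
      window x + multiples x          ≡⟨ window+multiples x ⟩
      multiples (x + c)               ≡⟨ cong (λ n → multiples (x + n)) (m≡m%n+[m/n]*n c d) ⟩
      multiples (x + (r + q ℕ.* d))   ≡⟨ cong multiples (sym (ℕP.+-assoc x r _)) ⟩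
      multiples ((x + r) + q ℕ.* d)   ≡⟨ multiples-+* q (x + r) ⟩
      q + multiples (x + r)           ∎

  excess-<t : ∀ {x} → x < t → excess x ≡ 0
  excess-<t {x} x<t = trans (excess-<d (ℕP.<-≤-trans x<t (ℕP.m∸n≤m d r)))
                            (multiples-< (subst (x + r <_) t+r≡d (ℕP.+-monoˡ-< r x<t)))

  excess-≥t : ∀ {x} → t ≤ x → x < d → excess x ≡ 1
  excess-≥t {x} t≤x x<d = begin-equality
    excess x            ≡⟨ excess-<d x<d ⟩
    multiples (x + r)   ≡⟨ cong multiples (sym (ℕP.m+[n∸m]≡n d≤x+r)) ⟩
    multiples (d + s)   ≡⟨ multiples-d+ s ⟩
    suc (multiples s)   ≡⟨ cong suc (multiples-< (ℕP.m<n+o⇒m∸n<o (x + r) d (ℕP.+-mono-< x<d r<d))) ⟩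
    1                   ∎
    where
    d≤x+r : d ≤ x + r
    d≤x+r = subst (_≤ x + r) t+r≡d (ℕP.+-monoˡ-≤ r t≤x)
    s = x + r ∸ d

  excessSum-≤d : ∀ {a} → a ≤ d → excessSum a ≡ a ∸ t
  excessSum-≤d {zero}  _   = sym (ℕP.0∸n≡0 t)
  excessSum-≤d {suc a} a<d with t ℕ.≤? a
  ... | yes t≤a = begin-equality
    excessSum (suc a)        ≡⟨ ∑-last a excess ⟩
    excessSum a + excess a   ≡⟨ cong₂ _+_ (excessSum-≤d (ℕP.<⇒≤ a<d)) (excess-≥t t≤a a<d) ⟩
    (a ∸ t) + 1              ≡⟨ ℕP.+-comm (a ∸ t) 1 ⟩
    suc (a ∸ t)              ≡⟨ sym (ℕP.+-∸-assoc 1 t≤a) ⟩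
    suc a ∸ t                ∎
  ... | no  t≰a = begin-equality
    excessSum (suc a)        ≡⟨ ∑-last a excess ⟩
    excessSum a + excess a   ≡⟨ cong₂ _+_ (excessSum-≤d (ℕP.<⇒≤ a<d)) (excess-<t a<t) ⟩
    (a ∸ t) + 0              ≡⟨ cong (_+ 0) (ℕP.m≤n⇒m∸n≡0 (ℕP.<⇒≤ a<t)) ⟩
    0                        ≡⟨ sym (ℕP.m≤n⇒m∸n≡0 a<t) ⟩
    suc a ∸ t                ∎
    where a<t = ℕP.≰⇒> t≰a

  excessSum-d+ : ∀ m → excessSum (d + m) ≡ r + excessSum m
  excessSum-d+ m = begin-equality
    excessSum (d + m)                          ≡⟨ ∑-+ d m excess ⟩
    excessSum d + ∑ m (λ i → excess (d + i))   ≡⟨ cong₂ _+_ excessSum-d (∑-cong m (λ i _ → excess-d+ i)) ⟩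
    r + excessSum m                            ∎
    where
    excessSum-d : excessSum d ≡ r
    excessSum-d = trans (excessSum-≤d ℕP.≤-refl) (ℕP.m∸[m∸n]≡n (ℕP.<⇒≤ r<d))
    excess-d+ : ∀ x → excess (d + x) ≡ excess x
    excess-d+ x = cong (_∸ multiples c) (window-d+ x)

  ≤-t+t+excessSum : ∀ m → m < d + d → m ≤ (t + t) + excessSum m
  ≤-t+t+excessSum m m<2d with m ℕ.≤? d
  ... | yes m≤d = begin
    m                        ≤⟨ ℕP.m≤n+m∸n m t ⟩
    t + (m ∸ t)              ≡⟨ cong (t +_) (sym (excessSum-≤d m≤d)) ⟩
    t + excessSum m          ≤⟨ ℕP.+-monoˡ-≤ (excessSum m) (ℕP.m≤m+n t t) ⟩
    (t + t) + excessSum m    ∎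
  ... | no  m≰d = begin
    m                              ≡⟨ sym (ℕP.m+[n∸m]≡n d≤m) ⟩
    d + s                          ≡⟨ cong (_+ s) (sym t+r≡d) ⟩
    (t + r) + s                    ≤⟨ ℕP.+-monoʳ-≤ (t + r) (ℕP.m≤n+m∸n s t) ⟩
    (t + r) + (t + (s ∸ t))        ≡⟨ interchange t r t (s ∸ t) ⟩
    (t + t) + (r + (s ∸ t))        ≡⟨ cong (λ u → (t + t) + (r + u)) (sym (excessSum-≤d s≤d)) ⟩
    (t + t) + (r + excessSum s)    ≡⟨ cong ((t + t) +_) (sym (excessSum-d+ s)) ⟩
    (t + t) + excessSum (d + s)    ≡⟨ cong (λ n → (t + t) + excessSum n) (ℕP.m+[n∸m]≡n d≤m) ⟩
    (t + t) + excessSum m          ∎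
    where
    d≤m = ℕP.<⇒≤ (ℕP.≰⇒> m≰d)
    s = m ∸ d
    s≤d : s ≤ d
    s≤d = ℕP.<⇒≤ (ℕP.m<n+o⇒m∸n<o m d m<2d)

  excessSum-superadditive : Superadditive excessSum
  excessSum-superadditive = superadditive-periodic d r excessSum-d+ below-d
    where
    excessSum-≤t : ∀ {a} → a ≤ t → excessSum a ≡ 0
    excessSum-≤t a≤t = trans (excessSum-≤d (ℕP.≤-trans a≤t (ℕP.m∸n≤m d r))) (ℕP.m≤n⇒m∸n≡0 a≤t)
    t+excessSum : ∀ {a} → t ≤ a → a ≤ d → t + excessSum a ≡ a
    t+excessSum t≤a a≤d = trans (cong (t +_) (excessSum-≤d a≤d)) (ℕP.m+[n∸m]≡n t≤a)
    below-d : ∀ a b → a < d → b < d → excessSum a + excessSum b ≤ excessSum (a + b)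
    below-d a b a<d b<d with t ℕ.≤? a | t ℕ.≤? b
    ... | no t≰a | _ = begin
      excessSum a + excessSum b   ≡⟨ cong (_+ excessSum b) (excessSum-≤t (ℕP.<⇒≤ (ℕP.≰⇒> t≰a))) ⟩
      excessSum b                 ≤⟨ ∑-≤-+ b a excess ⟩
      excessSum (b + a)           ≡⟨ cong excessSum (ℕP.+-comm b a) ⟩
      excessSum (a + b)           ∎
    ... | yes _ | no t≰b = begin
      excessSum a + excessSum b   ≡⟨ cong (excessSum a +_) (excessSum-≤t (ℕP.<⇒≤ (ℕP.≰⇒> t≰b))) ⟩
      excessSum a + 0             ≡⟨ ℕP.+-identityʳ _ ⟩
      excessSum a                 ≤⟨ ∑-≤-+ a b excess ⟩
      excessSum (a + b)           ∎
    ... | yes t≤a | yes t≤b = ℕP.+-cancelˡ-≤ (t + t) _ _ (begin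
      (t + t) + (excessSum a + excessSum b)    ≡⟨ interchange t t (excessSum a) (excessSum b) ⟩
      (t + excessSum a) + (t + excessSum b)
        ≡⟨ cong₂ _+_ (t+excessSum t≤a (ℕP.<⇒≤ a<d)) (t+excessSum t≤b (ℕP.<⇒≤ b<d)) ⟩
      a + b                                    ≤⟨ ≤-t+t+excessSum (a + b) (ℕP.+-mono-< a<d b<d) ⟩
      (t + t) + excessSum (a + b)              ∎)

module Column (g : ℕ → ℤ) (g≢0 : ∀ d → 1 ≤ d → g d ≢ 0ℤ) (c : ℕ) where

  open Monomial g
  open Multiples using (excess; excessSum-superadditive; multiples≤window)

  exponent : ℕ → ℕ → ℕ
  exponent x d = excess (ℕ.pred d) c x

  column-monomial : ∀ {M} x → x + c ≤ M → column (divProd g) c (suc x) ≡ toℚ (monomial M (exponent x))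
  column-monomial {M} x x+c≤M =
    hbinom-monomial g≢0 (divProd g) M (λ N d → [ d ∣ N ]) (ℕP.m≤n+m c x)
      (λ N 1≤N N≤x+c → divProd-monomial 1≤N (ℕP.≤-trans N≤x+c x+c≤M))
      (λ d → multiples≤window d c x)

  column-≢0 : ∀ N → 1 ≤ N → column (divProd g) c N ≢ 0ℚ
  column-≢0 (suc x) _ C≡0 =
    monomial-≢0 g≢0 (suc x + c) (exponent x)
      (toℚ-injective (trans (sym (column-monomial x (ℕP.n≤1+n _))) C≡0))

  hbinom-column-isInteger : ∀ n k → k ≤ n → IsInteger (hbinom (column (divProd g) c) n k)
  hbinom-column-isInteger n k k≤n = monomial (n + c) binomialExponent ,
    hbinom-monomial g≢0 (column (divProd g) c) (n + c) (exponent ∘ ℕ.pred) k≤n column≡ exponent-sums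
    where
    binomialExponent : ℕ → ℕ
    binomialExponent d = ∑ k (λ i → exponent (ℕ.pred (n ∸ i)) d) ∸ ∑ k (λ i → exponent i d)
    column≡ : ∀ N → 1 ≤ N → N ≤ n →
              column (divProd g) c N ≡ toℚ (monomial (n + c) (exponent (ℕ.pred N)))
    column≡ (suc x) _ x<n = column-monomial x (ℕP.+-monoˡ-≤ c (ℕP.<⇒≤ x<n))
    exponent-sums : ∀ d →
                    ∑ k (λ i → exponent i (suc d)) ≤ ∑ k (λ i → exponent (ℕ.pred (n ∸ i)) (suc d))
    exponent-sums d = subst (∑ k (excess d c) ≤_)
                            (∑-cong k (λ i _ → cong (excess d c) (sym (ℕP.pred[m∸n]≡m∸[1+n] n i))))
                            (superadditive-∑⇒initial≤final (excess d c) (excessSum-superadditive d c) k≤n)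

theorem3p5 : (g : ℕ → ℤ) → (∀ d → 1 ≤ d → g d ≢ 0ℤ) →
    ∀ (c : ℕ) → Binomid (column (divProd g) c)
theorem3p5 g g≢0 c = column-≢0 , hbinom-column-isInteger
  where open Column g g≢0 c
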